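{- Let $G$ be a connected non-bipartite graph and $u\in V(G)$, and let $G''$ be a split of $u$ into vertices $u',u''$, with $N(u')\cup N(u'')=N_G(u)$ and $N(u')\cap N(u'')=\emptyset$. If $G''$ is connected and bipartite, then $\mathcal{N}(G'')$ is the disjoint union of two connected components $A$ and $B$ where the face $N_{G''}(u')$ and the vertex $u''$ lie in $A$, and the face $N_{G''}(u'')$ and the vertex $u'$ lie in $B$.
   Context: A split of a vertex $u$ of $G$ is a graph obtained by replacing $u$ with two new vertices $u',u''$ (keeping $G\setminus\{u\}$ unchanged) such that $N(u')\cup N(u'')=N_G(u)$ and $N(u')\cap N(u'')=\emptyset$. The neighborhood complex $\mathcal{N}(H)$ is the simplicial complex on $V(H)$ whose faces are all subsets of the sets $N_H(v)$, $v\in V(H)$, where $N_H(v)$ is the neighbor set of $v$. -}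

module Defs where

open import Data.Nat using (ℕ; suc)
open import Data.Fin using (Fin; zero; suc; punchIn)
open import Data.Bool using (Bool)
open import Data.Product using (Σ; _×_; ∃)
open import Data.Sum using (_⊎_)
open import Relation.Nullary using (¬_)
open import Relation.Binary.PropositionalEquality using (_≡_; _≢_)

record Graph (n : ℕ) : Set₁ where
  field
    Adj    : Fin n → Fin n → Set
    sym    : ∀ {x y} → Adj x y → Adj y x
    irrefl : ∀ {x} → ¬ Adj x x
open Graph public

data Reach {n : ℕ} (G : Graph n) (x : Fin n) : Fin n → Set where
  here : Reach G x x
  step : ∀ {y z} → Reach G x y → Adj G y z → Reach G x z

Connected : ∀ {n} → Graph n → Set
Connected {n} G = ∀ (x y : Fin n) → Reach G x y

Bipartite : ∀ {n} → Graph n → Set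
Bipartite {n} G = Σ (Fin n → Bool) λ c → ∀ {x y} → Adj G x y → c x ≢ c y

-- The remaining vertex suc (suc i) of G''
-- is identified with vertex punchIn u i of G (the i-th vertex of G ∖ {u}).
u′ : ∀ {n} → Fin (suc (suc n))
u′ = zero

u″ : ∀ {n} → Fin (suc (suc n))
u″ = suc zero

old : ∀ {n} → Fin n → Fin (suc (suc n))
old i = suc (suc i)

record IsSplit {n : ℕ} (G : Graph (suc n)) (u : Fin (suc n))
               (G″ : Graph (suc (suc n))) : Set where
  field
    keep→   : ∀ i j → Adj G″ (old i) (old j) → Adj G (punchIn u i) (punchIn u j)
    keep←   : ∀ i j → Adj G (punchIn u i) (punchIn u j) → Adj G″ (old i) (old j)
    union→  : ∀ i → Adj G″ u′ (old i) ⊎ Adj G″ u″ (old i) → Adj G u (punchIn u i)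
    union←  : ∀ i → Adj G u (punchIn u i) → Adj G″ u′ (old i) ⊎ Adj G″ u″ (old i)
    -- u' and u'' are not in N_G(u), hence not neighbours of each other
    noEdge  : ¬ Adj G″ u′ u″
    disjoint : ∀ i → ¬ (Adj G″ u′ (old i) × Adj G″ u″ (old i))

-- Connectivity in the neighborhood complex N(H): two vertices are joined by
-- an edge of the complex iff they lie in a common face, i.e. both lie in
-- N_H(v) for some v.
data ComplexReach {n : ℕ} (H : Graph n) (x : Fin n) : Fin n → Set where
  here : ComplexReach H x x
  step : ∀ {y z} → ComplexReach H x y → (v : Fin n) →
         Adj H v y → Adj H v z → ComplexReach H x z

-- In a bipartite graph two vertices with a common neighbour have the same
-- colour, and conversely a walk of even length is a chain of such pairs; so
-- the components of N(G″) are the two colour classes of the connected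
-- bipartite G″.  If u′ and u″ had the same colour, identifying them would
-- 2-colour G; hence they lie in different classes, and every neighbour of u′
-- has the colour of u″ and vice versa.
module Submission where

open import Defs
open import Data.Nat using (ℕ; suc)
open import Data.Fin using (Fin; punchOut)
open import Data.Fin.Properties using (_≟_; punchIn-punchOut)
open import Data.Bool using (Bool; true; false; not)
open import Data.Bool.Properties using (not-injective; ¬-not) renaming (_≟_ to _≟ᵇ_)
open import Data.Product using (Σ; ∃; _×_; _,_)
open import Data.Sum using (_⊎_; inj₁; inj₂)
open import Function using (_∘_)
open import Relation.Nullary using (¬_; yes; no; contradiction)
open import Relation.Binary.PropositionalEquality
  using (_≡_; _≢_; refl; trans; subst; subst₂; ≢-sym) renaming (sym to ≡-sym)

ProperColouring : ∀ {m} → Graph m → (Fin m → Bool) → Set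
ProperColouring H col = ∀ {x y} → Adj H x y → col x ≢ col y

≢-same⇒≡ : ∀ {a b c : Bool} → a ≢ b → c ≢ b → a ≡ c
≢-same⇒≡ a≢b c≢b = trans (¬-not a≢b) (≡-sym (¬-not c≢b))

-- The two alternatives are walks of even and of odd length.
reach⇒complexReach⊎adjacent : ∀ {m} (H : Graph m) {x z} → Reach H x z →
  ComplexReach H x z ⊎ ∃ λ y → ComplexReach H x y × Adj H y z
reach⇒complexReach⊎adjacent H here = inj₁ here
reach⇒complexReach⊎adjacent H (step {y} x⇝y y~z) with reach⇒complexReach⊎adjacent H x⇝y
... | inj₁ x≈y             = inj₂ (y , x≈y , y~z)
... | inj₂ (w , x≈w , w~y) = inj₁ (step x≈w y (Graph.sym H w~y) y~z)

module _ {m} (H : Graph m) {col : Fin m → Bool} (proper : ProperColouring H col) where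

  complexReach⇒sameColour : ∀ {x z} → ComplexReach H x z → col x ≡ col z
  complexReach⇒sameColour here = refl
  complexReach⇒sameColour (step x≈y v v~y v~z) =
    trans (complexReach⇒sameColour x≈y) (≢-same⇒≡ (≢-sym (proper v~y)) (≢-sym (proper v~z)))

  sameColour⇒complexReach : Connected H → ∀ x z → col x ≡ col z → ComplexReach H x z
  sameColour⇒complexReach connected x z same with reach⇒complexReach⊎adjacent H (connected x z)
  ... | inj₁ x≈z             = x≈z
  ... | inj₂ (y , x≈y , y~z) =
    contradiction (trans (≡-sym (complexReach⇒sameColour x≈y)) same) (proper y~z)

colouring-with-value : ∀ {m} (H : Graph m) → Bipartite H → ∀ v b →
  Σ (Fin m → Bool) λ col → ProperColouring H col × col v ≡ b
colouring-with-value H (col , proper) v b with col v ≟ᵇ b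
... | yes colv≡b = col , proper , colv≡b
... | no  colv≢b = not ∘ col , (λ x~y → proper x~y ∘ not-injective) , ≡-sym (¬-not (≢-sym colv≢b))

module _ {n} {G : Graph (suc n)} {u : Fin (suc n)} {G″ : Graph (suc (suc n))}
         (split : IsSplit G u G″) where
  open IsSplit split

  neighbour-of-u : ∀ {w} (u≢w : u ≢ w) → Adj G u w →
    Adj G″ u′ (old (punchOut u≢w)) ⊎ Adj G″ u″ (old (punchOut u≢w))
  neighbour-of-u u≢w u~w =
    union← (punchOut u≢w) (subst (Adj G u) (≡-sym (punchIn-punchOut u≢w)) u~w)

  edge-avoiding-u : ∀ {x y} (u≢x : u ≢ x) (u≢y : u ≢ y) → Adj G x y →
    Adj G″ (old (punchOut u≢x)) (old (punchOut u≢y))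
  edge-avoiding-u u≢x u≢y x~y =
    keep← (punchOut u≢x) (punchOut u≢y)
      (subst₂ (Adj G) (≡-sym (punchIn-punchOut u≢x)) (≡-sym (punchIn-punchOut u≢y)) x~y)

  merged : (Fin (suc (suc n)) → Bool) → Fin (suc n) → Bool
  merged col w with u ≟ w
  ... | yes _   = col u′
  ... | no u≢w = col (old (punchOut u≢w))

  module _ {col : Fin (suc (suc n)) → Bool} (proper : ProperColouring G″ col)
           (same : col u′ ≡ col u″) where

    neighbour-of-u-colour : ∀ {w} (u≢w : u ≢ w) → Adj G u w → col u′ ≢ col (old (punchOut u≢w))
    neighbour-of-u-colour u≢w u~w with neighbour-of-u u≢w u~w
    ... | inj₁ u′~w = proper u′~w
    ... | inj₂ u″~w = proper u″~w ∘ trans (≡-sym same)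

    merged-proper : ProperColouring G (merged col)
    merged-proper {x} {y} x~y with u ≟ x | u ≟ y
    ... | yes refl | yes refl = contradiction x~y (Graph.irrefl G)
    ... | yes refl | no u≢y   = neighbour-of-u-colour u≢y x~y
    ... | no u≢x   | yes refl = ≢-sym (neighbour-of-u-colour u≢x (Graph.sym G x~y))
    ... | no u≢x   | no u≢y   = proper (edge-avoiding-u u≢x u≢y x~y)

  split-halves-differ : ¬ Bipartite G → ∀ {col} → ProperColouring G″ col → col u′ ≢ col u″
  split-halves-differ non-bipartite proper same =
    non-bipartite (merged _ , merged-proper proper same)

lemma5p3 : ∀ {n : ℕ} (G : Graph (suc n)) (u : Fin (suc n)) (G″ : Graph (suc (suc n))) →
    IsSplit G u G″ → Connected G → ¬ Bipartite G →
    Connected G″ → Bipartite G″ →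
    Σ (Fin (suc (suc n)) → Bool) λ c →
      (∀ x y → (ComplexReach G″ x y → c x ≡ c y) × (c x ≡ c y → ComplexReach G″ x y))
      × (∀ x → Adj G″ u′ x → c x ≡ true) × c u″ ≡ true
      × (∀ x → Adj G″ u″ x → c x ≡ false) × c u′ ≡ false
lemma5p3 G u G″ split _ non-bipartite connected″ bipartite″
  with colouring-with-value G″ bipartite″ u″ true
... | c , proper , cu″≡true =
  c , components , near-u′ , cu″≡true , near-u″ , cu′≡false
  where
  components : ∀ x y → (ComplexReach G″ x y → c x ≡ c y) × (c x ≡ c y → ComplexReach G″ x y)
  components x y = complexReach⇒sameColour G″ proper , sameColour⇒complexReach G″ proper connected″ x y

  cu′≡false : c u′ ≡ false
  cu′≡false = ¬-not (subst (c u′ ≢_) cu″≡true (split-halves-differ split non-bipartite proper))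

  near-u′ : ∀ x → Adj G″ u′ x → c x ≡ true
  near-u′ x u′~x = ¬-not (subst (c x ≢_) cu′≡false (≢-sym (proper u′~x)))

  near-u″ : ∀ x → Adj G″ u″ x → c x ≡ false
  near-u″ x u″~x = ¬-not (subst (c x ≢_) cu″≡true (≢-sym (proper u″~x)))
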